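{- Let $p$ be the partially ordered pattern of length $4$ on the labels $\{1,2,3,4\}$ whose only relation is $1>2$. Let $a(n)$ be the number of $n$-permutations avoiding $p$. Then $$a(n)=\begin{cases} n! & \text{if } n=0,1,2,3,\\ n(n-1) & \text{if } n\geq 4,\end{cases}\qquad \sum_{n\geq 0}a(n)x^n=\frac{1-2x+2x^2+2x^3-x^4}{(1-x)^3}.$$
   Context: An $n$-permutation is a permutation $\pi=\pi_1\cdots\pi_n$ of $\{1,\dots,n\}$ written in one-line notation (for $n=0$ there is exactly one, the empty permutation). A partially ordered pattern (POP) $p$ of length $k$ is a partial order $<_P$ on the label set $\{1,\dots,k\}$. An occurrence of $p$ in $\pi$ is a subsequence $\pi_{i_1}\pi_{i_2}\cdots\pi_{i_k}$ with $1\leq i_1<\cdots<i_k\leq n$ such that $\pi_{i_j}<\pi_{i_m}$ whenever $j<_P m$ (no condition is imposed on pairs of incomparable labels). A permutation avoids $p$ if it contains no occurrence of $p$. -}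

module Defs where

open import Data.Nat using (ℕ; zero; suc; _∸_)
open import Data.Nat using (_!)
open import Data.Fin using (Fin; toℕ; fromℕ) renaming (_<_ to _<ᶠ_)
open import Data.Fin.Patterns using (0F; 1F)
open import Data.Vec using (Vec; lookup)
open import Data.Product using (Σ; _×_)
open import Data.Integer using (ℤ; +_; _+_; _*_)
open import Relation.Binary.PropositionalEquality using (_≡_)
open import Relation.Nullary using (¬_)

-- An n-permutation in one-line notation: π = π₁⋯πₙ stored as a vector of
-- values in Fin n (value v ∈ Fin n stands for v+1 ∈ {1..n}), all distinct.
IsPerm : {n : ℕ} → Vec (Fin n) n → Set
IsPerm {n} π = (i j : Fin n) → lookup π i ≡ lookup π j → i ≡ j

POP : ℕ → Set₁
POP k = Fin k → Fin k → Set

Occurs : {k n : ℕ} → POP k → Vec (Fin n) n → Set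
Occurs {k} {n} p π =
  Σ (Fin k → Fin n) λ ι →
    ((j m : Fin k) → j <ᶠ m → ι j <ᶠ ι m) ×
    ((j m : Fin k) → p j m → lookup π (ι j) <ᶠ lookup π (ι m))

Avoids : {k n : ℕ} → POP k → Vec (Fin n) n → Set
Avoids p π = ¬ Occurs p π

-- The POP of length 4 whose only relation is 1 > 2, i.e. 2 <_P 1.
-- (Label ℓ is represented by the element ℓ-1 of Fin 4.)
data p12 : Fin 4 → Fin 4 → Set where
  two<one : p12 1F 0F

aFormula : ℕ → ℕ
aFormula 0 = 0 !
aFormula 1 = 1 !
aFormula 2 = 2 !
aFormula 3 = 3 !
aFormula n@(suc (suc (suc (suc _)))) = n Data.Nat.* (n ∸ 1)

Series : Set
Series = ℕ → ℤ

sumTo : ℕ → (ℕ → ℤ) → ℤ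
sumTo zero    f = f 0
sumTo (suc n) f = sumTo n f + f (suc n)

_⊛_ : Series → Series → Series
(f ⊛ g) n = sumTo n (λ i → f i * g (n ∸ i))

oneMinusXCubed : Series
oneMinusXCubed 0 = + 1
oneMinusXCubed 1 = Data.Integer.- (+ 3)
oneMinusXCubed 2 = + 3
oneMinusXCubed 3 = Data.Integer.- (+ 1)
oneMinusXCubed _ = + 0

numerator : Series
numerator 0 = + 1
numerator 1 = Data.Integer.- (+ 2)
numerator 2 = + 2
numerator 3 = + 2
numerator 4 = Data.Integer.- (+ 1)
numerator _ = + 0

-- Labels 3 and 4 of the pattern are unconstrained, so an n-permutation with n ≥ 2 contains it
-- exactly when its first n − 2 entries contain an inversion. The avoiders are therefore the
-- permutations with increasing prefix, and such a permutation is determined by its last two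
-- values, an arbitrary ordered pair of distinct values: n(n − 1) choices. For n ≥ 7 the
-- coefficient of xⁿ in (1 − x)³ Σ a(n) xⁿ is a third difference of n(n − 1), hence 0.
module Submission where

open import Defs
open import Data.Nat as ℕ using (ℕ; zero; suc; z≤n; s≤s)
import Data.Nat.Properties as ℕ
open import Data.Fin using (Fin; zero; suc; toℕ; fromℕ; fromℕ<; inject₁; punchIn; punchOut; opposite; _<_)
open import Data.Fin.Properties
  using ( toℕ-injective; toℕ<n; toℕ-inject₁; toℕ-fromℕ; toℕ-fromℕ<; inject₁-injective; fromℕ≢inject₁
        ; ≤̄⇒inject₁<; ≤-refl; <-cmp; <-asym; <-irrefl; <-trans
        ; opposite-prop; opposite-involutive
        ; punchIn-mono-≤; punchIn-injective; punchIn-punchOut; punchInᵢ≢i )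
open import Data.Fin.Patterns using (0F; 1F; 2F; 3F)
open import Data.Fin.Relation.Unary.Top using (View; ‵fromℕ; ‵inj₁; ‵inject₁; view; view-fromℕ; view-inject₁)
open import Data.Vec using (Vec; []; _∷_; lookup; tabulate)
open import Data.Vec.Properties using (lookup∘tabulate; tabulate∘lookup; tabulate-cong)
open import Data.Vec.Relation.Unary.Linked using (Linked; [-]; _∷_)
import Data.Vec.Relation.Unary.Linked.Properties as Linked
open import Data.List using (List; [_]; length; map; cartesianProductWith; allFin) renaming ([] to []ˡ; _∷_ to _∷ˡ_)
open import Data.List.Properties using (length-++; length-map; length-tabulate)
open import Data.List.Membership.Propositional using (_∈_)
import Data.List.Relation.Unary.All as All
import Data.List.Relation.Unary.AllPairs as AllPairs
open import Data.List.Relation.Unary.Any using (here)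
open import Data.List.Membership.Propositional.Properties using (∈-cartesianProductWith⁺; ∈-cartesianProductWith⁻; ∈-allFin)
open import Data.List.Relation.Unary.Unique.Propositional using (Unique)
open import Data.List.Relation.Unary.Unique.Propositional.Properties using (cartesianProductWith⁺; allFin⁺)
open import Data.Integer using (ℤ; +_; _+_; _-_; _*_; -_)
import Data.Integer.Properties as ℤ
open import Data.Integer.Tactic.RingSolver using (solve-∀)
open import Data.Product using (Σ; ∃₂; _×_; _,_)
open import Function.Base using (_∘_; id)
open import Function.Bundles using (_⇔_; mk⇔; Equivalence)
open import Function.Definitions using (Injective)
open import Relation.Binary.Core using (_Preserves_⟶_)
open import Relation.Binary.Definitions using (tri<; tri≈; tri>)
open import Relation.Binary.PropositionalEquality
  using (_≡_; _≢_; refl; sym; trans; cong; cong₂; subst; subst₂; module ≡-Reasoning)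
open import Relation.Nullary using (¬_; contradiction)

private
  variable
    m n : ℕ

StrictlyIncreasing : (Fin m → Fin n) → Set
StrictlyIncreasing f = f Preserves _<_ ⟶ _<_

inject₁-mono-< : {i j : Fin n} → i < j → inject₁ i < inject₁ j
inject₁-mono-< {i = i} {j} = subst₂ ℕ._<_ (sym (toℕ-inject₁ i)) (sym (toℕ-inject₁ j))

increasing⇒inflationary : (f : Fin m → Fin n) → StrictlyIncreasing f → ∀ i → toℕ i ℕ.≤ toℕ (f i)
increasing⇒inflationary f f↑ zero    = z≤n
increasing⇒inflationary f f↑ (suc i) =
  ℕ.≤-trans (s≤s (increasing⇒inflationary (f ∘ inject₁) (f↑ ∘ inject₁-mono-<) i))
            (f↑ (≤̄⇒inject₁< ≤-refl))

increasing⇒reflects-< : {f : Fin m → Fin n} → StrictlyIncreasing f →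
                        ∀ {i j} → f i < f j → i < j
increasing⇒reflects-< f↑ {i} {j} fi<fj with <-cmp i j
... | tri< i<j _ _ = i<j
... | tri≈ _ refl _ = contradiction fi<fj (<-irrefl refl)
... | tri> _ _ j<i = contradiction (f↑ j<i) (<-asym fi<fj)

opposite-anti-< : {i j : Fin n} → i < j → opposite j < opposite i
opposite-anti-< {i = i} {j} i<j =
  subst₂ ℕ._<_ (sym (opposite-prop j)) (sym (opposite-prop i)) (ℕ.∸-monoʳ-< (s≤s i<j) (toℕ<n j))

-- The upper bound f i ≤ i is inflationarity of the conjugate  opposite ∘ f ∘ opposite.
increasing-endo⇒≗id : (f : Fin n → Fin n) → StrictlyIncreasing f → ∀ i → f i ≡ i
increasing-endo⇒≗id {n} f f↑ i =
  toℕ-injective (ℕ.≤-antisym deflationary (increasing⇒inflationary f f↑ i))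
  where
  conjugate↑ : StrictlyIncreasing (opposite ∘ f ∘ opposite)
  conjugate↑ = opposite-anti-< ∘ f↑ ∘ opposite-anti-<

  opposite-≤ : toℕ (opposite i) ℕ.≤ toℕ (opposite (f i))
  opposite-≤ = subst (λ j → toℕ (opposite i) ℕ.≤ toℕ (opposite (f j))) (opposite-involutive i)
    (increasing⇒inflationary (opposite ∘ f ∘ opposite) conjugate↑ (opposite i))

  deflationary : toℕ (f i) ℕ.≤ toℕ i
  deflationary = ℕ.≤-pred (ℕ.∸-cancelʳ-≤ (toℕ<n (f i))
    (subst₂ ℕ._≤_ (opposite-prop i) (opposite-prop (f i)) opposite-≤))

punchIn-mono-< : (x : Fin (suc n)) → StrictlyIncreasing (punchIn x)
punchIn-mono-< x {i} {j} i<j = ℕ.≤∧≢⇒< (punchIn-mono-≤ x i j (ℕ.<⇒≤ i<j))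
  (λ eq → <-irrefl (punchIn-injective x i j (toℕ-injective eq)) i<j)

punchOut-increasing : {x : Fin (suc n)} {f : Fin m → Fin (suc n)} → StrictlyIncreasing f →
                      (x∉f : ∀ k → x ≢ f k) → StrictlyIncreasing (λ k → punchOut (x∉f k))
punchOut-increasing {x = x} f↑ x∉f {k} {l} k<l = increasing⇒reflects-< (punchIn-mono-< x)
  (subst₂ _<_ (sym (punchIn-punchOut (x∉f k))) (sym (punchIn-punchOut (x∉f l))) (f↑ k<l))

increasing-missing⇒≗punchIn : {x : Fin (suc m)} {f : Fin m → Fin (suc m)} →
  StrictlyIncreasing f → (∀ k → x ≢ f k) → ∀ k → f k ≡ punchIn x k
increasing-missing⇒≗punchIn {x = x} {f} f↑ x∉f k = begin
  f k                          ≡⟨ punchIn-punchOut (x∉f k) ⟨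
  punchIn x (punchOut (x∉f k)) ≡⟨ cong (punchIn x) (increasing-endo⇒≗id _ (punchOut-increasing f↑ x∉f) k) ⟩
  punchIn x k                  ∎
  where open ≡-Reasoning

increasing-missing₂⇒≗punchIn : {x : Fin (suc (suc m))} {y : Fin (suc m)} {f : Fin m → Fin (suc (suc m))} →
  StrictlyIncreasing f → (∀ k → x ≢ f k) → (∀ k → punchIn x y ≢ f k) →
  ∀ k → f k ≡ punchIn x (punchIn y k)
increasing-missing₂⇒≗punchIn {m} {x = x} {y} {f} f↑ x∉f y∉f k = begin
  f k                     ≡⟨ punchIn-punchOut (x∉f k) ⟨
  punchIn x (g k)         ≡⟨ cong (punchIn x) (increasing-missing⇒≗punchIn (punchOut-increasing f↑ x∉f) y∉g k) ⟩
  punchIn x (punchIn y k) ∎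
  where
  open ≡-Reasoning
  g : Fin m → Fin (suc m)
  g k = punchOut (x∉f k)
  y∉g : ∀ k → y ≢ g k
  y∉g k y≡gk = y∉f k (trans (cong (punchIn x) y≡gk) (punchIn-punchOut (x∉f k)))

Inversion : (Fin m → Fin n) → Set
Inversion f = ∃₂ λ k l → k < l × f l < f k

increasing⇒¬inversion : {f : Fin m → Fin n} → StrictlyIncreasing f → ¬ Inversion f
increasing⇒¬inversion f↑ (k , l , k<l , fl<fk) = <-asym fl<fk (f↑ k<l)

injective∧¬inversion⇒increasing : {f : Fin m → Fin n} → Injective _≡_ _≡_ f → ¬ Inversion f →
                                  StrictlyIncreasing f
injective∧¬inversion⇒increasing {f = f} f-inj ¬inv {k} {l} k<l with <-cmp (f k) (f l)
... | tri< fk<fl _ _ = fk<fl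
... | tri≈ _ fk≡fl _ = contradiction (f-inj fk≡fl) (λ k≡l → <-irrefl k≡l k<l)
... | tri> _ _ fl<fk = contradiction (k , l , k<l , fl<fk) ¬inv

occurs⇒length≤ : {k : ℕ} {p : POP k} {π : Vec (Fin n) n} → Occurs p π → k ℕ.≤ n
occurs⇒length≤ {k = zero}  _               = z≤n
occurs⇒length≤ {k = suc k} (ι , ι↑ , _) = ℕ.≤-trans
  (s≤s (subst (ℕ._≤ toℕ (ι (fromℕ k))) (toℕ-fromℕ k) (increasing⇒inflationary ι (ι↑ _ _) (fromℕ k))))
  (toℕ<n (ι (fromℕ k)))

front : Fin m → Fin (suc (suc m))
front = inject₁ ∘ inject₁

penultimate : Fin (suc (suc m))
penultimate {m} = inject₁ (fromℕ m)

ultimate : Fin (suc (suc m))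
ultimate {m} = fromℕ (suc m)

prefix : {A : Set} → Vec A (suc (suc m)) → Fin m → A
prefix π = lookup π ∘ front

toℕ-front : (k : Fin m) → toℕ (front k) ≡ toℕ k
toℕ-front k = trans (toℕ-inject₁ (inject₁ k)) (toℕ-inject₁ k)

toℕ-penultimate : toℕ (penultimate {m}) ≡ m
toℕ-penultimate {m} = trans (toℕ-inject₁ (fromℕ m)) (toℕ-fromℕ m)

front-fromℕ< : (i : Fin (suc (suc m))) (i<m : toℕ i ℕ.< m) → front (fromℕ< i<m) ≡ i
front-fromℕ< i i<m = toℕ-injective (trans (toℕ-front (fromℕ< i<m)) (toℕ-fromℕ< i<m))

front-injective : Injective _≡_ _≡_ (front {m})
front-injective = inject₁-injective ∘ inject₁-injective

front≢penultimate : (k : Fin m) → front k ≢ penultimate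
front≢penultimate k = fromℕ≢inject₁ ∘ sym ∘ inject₁-injective

front≢ultimate : (k : Fin m) → front k ≢ ultimate
front≢ultimate k = fromℕ≢inject₁ ∘ sym

penultimate≢ultimate : penultimate {m} ≢ ultimate
penultimate≢ultimate = fromℕ≢inject₁ ∘ sym

occurs-p12⇔inversion : (π : Vec (Fin (suc (suc m))) (suc (suc m))) →
                       Occurs p12 π ⇔ Inversion (prefix π)
occurs-p12⇔inversion {m = m} π = mk⇔ to from
  where
  to : Occurs p12 π → Inversion (prefix π)
  to (ι , ι↑ , ι-rel) = fromℕ< ι₀<m , fromℕ< ι₁<m , k<l , πl<πk
    where
    ι₀<ι₁ : ι 0F < ι 1F
    ι₀<ι₁ = ι↑ 0F 1F ℕ.≤-refl
    ι₁<m : toℕ (ι 1F) ℕ.< m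
    ι₁<m = ℕ.≤-pred (ℕ.≤-pred (ℕ.≤-<-trans (ℕ.≤-trans (s≤s (ι↑ 1F 2F ℕ.≤-refl)) (ι↑ 2F 3F ℕ.≤-refl))
                                           (toℕ<n (ι 3F))))
    ι₀<m : toℕ (ι 0F) ℕ.< m
    ι₀<m = ℕ.<-trans ι₀<ι₁ ι₁<m
    k<l : fromℕ< ι₀<m < fromℕ< ι₁<m
    k<l = subst₂ ℕ._<_ (sym (toℕ-fromℕ< ι₀<m)) (sym (toℕ-fromℕ< ι₁<m)) ι₀<ι₁
    πl<πk : prefix π (fromℕ< ι₁<m) < prefix π (fromℕ< ι₀<m)
    πl<πk = subst₂ (λ i j → lookup π i < lookup π j)
      (sym (front-fromℕ< _ ι₁<m)) (sym (front-fromℕ< _ ι₀<m)) (ι-rel _ _ two<one)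

  from : Inversion (prefix π) → Occurs p12 π
  from (k , l , k<l , πl<πk) =
    lookup positions , (λ _ _ → Linked.lookup⁺ <-trans positions↑) , π-rel
    where
    positions : Vec (Fin (suc (suc m))) 4
    positions = front k ∷ front l ∷ penultimate ∷ ultimate ∷ []
    positions↑ : Linked _<_ positions
    positions↑ = subst₂ ℕ._<_ (sym (toℕ-front k)) (sym (toℕ-front l)) k<l
               ∷ subst₂ ℕ._<_ (sym (toℕ-front l)) (sym toℕ-penultimate) (toℕ<n l)
               ∷ subst₂ ℕ._<_ (sym toℕ-penultimate) (sym (toℕ-fromℕ (suc m))) ℕ.≤-refl
               ∷ [-]
    π-rel : (i j : Fin 4) → p12 i j → lookup π (lookup positions i) < lookup π (lookup positions j)
    π-rel _ _ two<one = πl<πk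

-- The pair (x, y) encodes the last two values x and punchIn x y; the other values fill
-- the prefix in increasing order.
avoiderEntry : Fin (suc (suc m)) → Fin (suc m) → {i : Fin (suc (suc m))} → View i → Fin (suc (suc m))
avoiderEntry x y ‵fromℕ                = punchIn x y
avoiderEntry x y (‵inj₁ ‵fromℕ)        = x
avoiderEntry x y (‵inj₁ (‵inject₁ k)) = punchIn x (punchIn y k)

avoider : Fin (suc (suc m)) → Fin (suc m) → Vec (Fin (suc (suc m))) (suc (suc m))
avoider x y = tabulate (avoiderEntry x y ∘ view)

module _ (x : Fin (suc (suc m))) (y : Fin (suc m)) where

  lookup-avoider-front : (k : Fin m) → prefix (avoider x y) k ≡ punchIn x (punchIn y k)
  lookup-avoider-front k
    rewrite lookup∘tabulate (avoiderEntry x y ∘ view) (front k)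
          | view-inject₁ (inject₁ k) | view-inject₁ k = refl

  lookup-avoider-penultimate : lookup (avoider x y) penultimate ≡ x
  lookup-avoider-penultimate
    rewrite lookup∘tabulate (avoiderEntry x y ∘ view) (penultimate {m})
          | view-inject₁ (fromℕ m) | view-fromℕ m = refl

  lookup-avoider-ultimate : lookup (avoider x y) ultimate ≡ punchIn x y
  lookup-avoider-ultimate
    rewrite lookup∘tabulate (avoiderEntry x y ∘ view) (ultimate {m}) | view-fromℕ (suc m) = refl

  avoiderEntry-injective : ∀ {i j} (u : View i) (v : View j) → avoiderEntry x y u ≡ avoiderEntry x y v → i ≡ j
  avoiderEntry-injective ‵fromℕ ‵fromℕ _ = refl
  avoiderEntry-injective ‵fromℕ (‵inj₁ ‵fromℕ) eq = contradiction eq (punchInᵢ≢i x y)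
  avoiderEntry-injective ‵fromℕ (‵inj₁ (‵inject₁ k)) eq =
    contradiction (sym (punchIn-injective x _ _ eq)) (punchInᵢ≢i y k)
  avoiderEntry-injective (‵inj₁ ‵fromℕ) ‵fromℕ eq = contradiction (sym eq) (punchInᵢ≢i x y)
  avoiderEntry-injective (‵inj₁ ‵fromℕ) (‵inj₁ ‵fromℕ) _ = refl
  avoiderEntry-injective (‵inj₁ ‵fromℕ) (‵inj₁ (‵inject₁ k)) eq = contradiction (sym eq) (punchInᵢ≢i x _)
  avoiderEntry-injective (‵inj₁ (‵inject₁ k)) ‵fromℕ eq =
    contradiction (punchIn-injective x _ _ eq) (punchInᵢ≢i y k)
  avoiderEntry-injective (‵inj₁ (‵inject₁ k)) (‵inj₁ ‵fromℕ) eq = contradiction eq (punchInᵢ≢i x _)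
  avoiderEntry-injective (‵inj₁ (‵inject₁ k)) (‵inj₁ (‵inject₁ l)) eq =
    cong front (punchIn-injective y k l (punchIn-injective x _ _ eq))

  avoider-isPerm : IsPerm (avoider x y)
  avoider-isPerm i j eq = avoiderEntry-injective (view i) (view j) (begin
    avoiderEntry x y (view i) ≡⟨ lookup∘tabulate (avoiderEntry x y ∘ view) i ⟨
    lookup (avoider x y) i    ≡⟨ eq ⟩
    lookup (avoider x y) j    ≡⟨ lookup∘tabulate (avoiderEntry x y ∘ view) j ⟩
    avoiderEntry x y (view j) ∎)
    where open ≡-Reasoning

  avoider-avoids : Avoids p12 (avoider x y)
  avoider-avoids = increasing⇒¬inversion prefix↑ ∘ Equivalence.to (occurs-p12⇔inversion (avoider x y))
    where
    prefix↑ : StrictlyIncreasing (prefix (avoider x y))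
    prefix↑ {k} {l} = subst₂ _<_ (sym (lookup-avoider-front k)) (sym (lookup-avoider-front l))
                    ∘ punchIn-mono-< x ∘ punchIn-mono-< y

avoider-injective : {w x : Fin (suc (suc m))} {y z : Fin (suc m)} → avoider w y ≡ avoider x z → w ≡ x × y ≡ z
avoider-injective {w = w} {x} {y} {z} eq = w≡x , punchIn-injective w y z (begin
  punchIn w y                     ≡⟨ lookup-avoider-ultimate w y ⟨
  lookup (avoider w y) ultimate   ≡⟨ cong (λ π → lookup π ultimate) eq ⟩
  lookup (avoider x z) ultimate   ≡⟨ lookup-avoider-ultimate x z ⟩
  punchIn x z                     ≡⟨ cong (λ v → punchIn v z) w≡x ⟨
  punchIn w z                     ∎)
  where
  open ≡-Reasoning
  w≡x : w ≡ x
  w≡x = begin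
    w                                ≡⟨ lookup-avoider-penultimate w y ⟨
    lookup (avoider w y) penultimate ≡⟨ cong (λ π → lookup π penultimate) eq ⟩
    lookup (avoider x z) penultimate ≡⟨ lookup-avoider-penultimate x z ⟩
    x                                ∎

avoider-complete : (π : Vec (Fin (suc (suc m))) (suc (suc m))) → IsPerm π → Avoids p12 π →
                   ∃₂ λ x y → π ≡ avoider x y
avoider-complete π π-perm π-avoids =
  x , y , trans (sym (tabulate∘lookup π)) (tabulate-cong (entry ∘ view))
  where
  x = lookup π penultimate
  x≢πult : x ≢ lookup π ultimate
  x≢πult = penultimate≢ultimate ∘ π-perm penultimate ultimate
  y = punchOut x≢πult

  prefix↑ : StrictlyIncreasing (prefix π)
  prefix↑ = injective∧¬inversion⇒increasing (front-injective ∘ π-perm _ _)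
              (π-avoids ∘ Equivalence.from (occurs-p12⇔inversion π))

  x∉prefix : ∀ k → x ≢ prefix π k
  x∉prefix k = front≢penultimate k ∘ sym ∘ π-perm _ _

  xy∉prefix : ∀ k → punchIn x y ≢ prefix π k
  xy∉prefix k = front≢ultimate k ∘ sym ∘ π-perm _ _ ∘ trans (sym (punchIn-punchOut x≢πult))

  entry : ∀ {i} (v : View i) → lookup π i ≡ avoiderEntry x y v
  entry ‵fromℕ                = sym (punchIn-punchOut x≢πult)
  entry (‵inj₁ ‵fromℕ)        = refl
  entry (‵inj₁ (‵inject₁ k)) = increasing-missing₂⇒≗punchIn prefix↑ x∉prefix xy∉prefix k

AvoiderEnumeration : (n c : ℕ) → Set
AvoiderEnumeration n c = Σ (List (Vec (Fin n) n)) λ L →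
  Unique L × ((π : Vec (Fin n) n) → (π ∈ L) ⇔ (IsPerm π × Avoids p12 π)) × length L ≡ c

length-cartesianProductWith : {A B C : Set} (f : A → B → C) (xs : List A) (ys : List B) →
  length (cartesianProductWith f xs ys) ≡ length xs ℕ.* length ys
length-cartesianProductWith f []ˡ       ys = refl
length-cartesianProductWith f (x ∷ˡ xs) ys = trans (length-++ (map (f x) ys))
  (cong₂ ℕ._+_ (length-map (f x) ys) (length-cartesianProductWith f xs ys))

avoiders-≥2 : (m : ℕ) → AvoiderEnumeration (suc (suc m)) (suc (suc m) ℕ.* suc m)
avoiders-≥2 m = L , L-unique , ∈L⇔ , length-L
  where
  L = cartesianProductWith avoider (allFin (suc (suc m))) (allFin (suc m))

  L-unique : Unique L
  L-unique = cartesianProductWith⁺ avoider avoider-injective (allFin⁺ _) (allFin⁺ _)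

  ∈L⇔ : (π : Vec (Fin (suc (suc m))) (suc (suc m))) → (π ∈ L) ⇔ (IsPerm π × Avoids p12 π)
  ∈L⇔ π = mk⇔ to from
    where
    to : π ∈ L → IsPerm π × Avoids p12 π
    to π∈L with ∈-cartesianProductWith⁻ avoider (allFin _) (allFin _) π∈L
    ... | x , y , _ , _ , refl = avoider-isPerm x y , avoider-avoids x y
    from : IsPerm π × Avoids p12 π → π ∈ L
    from (π-perm , π-avoids) with avoider-complete π π-perm π-avoids
    ... | x , y , refl = ∈-cartesianProductWith⁺ avoider (∈-allFin x) (∈-allFin y)

  length-L : length L ≡ suc (suc m) ℕ.* suc m
  length-L = trans (length-cartesianProductWith avoider (allFin (suc (suc m))) (allFin (suc m)))
                   (cong₂ ℕ._*_ (length-tabulate {n = suc (suc m)} id) (length-tabulate {n = suc m} id))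

length<⇒avoids : {k : ℕ} {p : POP k} (π : Vec (Fin n) n) → n ℕ.< k → Avoids p π
length<⇒avoids π n<k = ℕ.<⇒≱ n<k ∘ occurs⇒length≤ {π = π}

aFormula-suc-suc : (m : ℕ) → aFormula (suc (suc m)) ≡ suc (suc m) ℕ.* suc m
aFormula-suc-suc zero          = refl
aFormula-suc-suc (suc zero)    = refl
aFormula-suc-suc (suc (suc m)) = refl

avoiders : (n : ℕ) → AvoiderEnumeration n (aFormula n)
avoiders zero = [ [] ] , All.[] AllPairs.∷ AllPairs.[] , ∈⇔ , refl
  where
  ∈⇔ : (π : Vec (Fin 0) 0) → (π ∈ [ [] ]) ⇔ (IsPerm π × Avoids p12 π)
  ∈⇔ [] = mk⇔ (λ _ → (λ ()) , length<⇒avoids [] (s≤s z≤n)) (λ _ → here refl)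
avoiders (suc zero) = [ zero ∷ [] ] , All.[] AllPairs.∷ AllPairs.[] , ∈⇔ , refl
  where
  ∈⇔ : (π : Vec (Fin 1) 1) → (π ∈ [ zero ∷ [] ]) ⇔ (IsPerm π × Avoids p12 π)
  ∈⇔ (zero ∷ []) =
    mk⇔ (λ _ → (λ { zero zero _ → refl }) , length<⇒avoids (zero ∷ []) (s≤s (s≤s z≤n))) (λ _ → here refl)
avoiders (suc (suc m)) = subst (AvoiderEnumeration _) (sym (aFormula-suc-suc m)) (avoiders-≥2 m)

sumTo-vanishing-tail : (n j : ℕ) (f : ℕ → ℤ) → (∀ i → f (suc (n ℕ.+ i)) ≡ + 0) →
                       sumTo (n ℕ.+ j) f ≡ sumTo n f
sumTo-vanishing-tail n zero    f f≡0 rewrite ℕ.+-identityʳ n = refl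
sumTo-vanishing-tail n (suc j) f f≡0 rewrite ℕ.+-suc n j | f≡0 j =
  trans (ℤ.+-identityʳ _) (sumTo-vanishing-tail n j f f≡0)

third-difference : (s : Series) (j : ℕ) →
  (oneMinusXCubed ⊛ s) (3 ℕ.+ j) ≡ s (3 ℕ.+ j) - + 3 * s (2 ℕ.+ j) + + 3 * s (1 ℕ.+ j) - s j
third-difference s j = begin
  (oneMinusXCubed ⊛ s) (3 ℕ.+ j)
    ≡⟨ sumTo-vanishing-tail 3 j _ (λ _ → refl) ⟩
  + 1 * s (3 ℕ.+ j) + - + 3 * s (2 ℕ.+ j) + + 3 * s (1 ℕ.+ j) + - + 1 * s j
    ≡⟨ normalise (s (3 ℕ.+ j)) (s (2 ℕ.+ j)) (s (1 ℕ.+ j)) (s j) ⟩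
  s (3 ℕ.+ j) - + 3 * s (2 ℕ.+ j) + + 3 * s (1 ℕ.+ j) - s j
    ∎
  where
  open ≡-Reasoning
  normalise : ∀ a b c d → + 1 * a + - + 3 * b + + 3 * c + - + 1 * d ≡ a - + 3 * b + + 3 * c - d
  normalise = solve-∀

pos-*-+ : (a b k : ℕ) → + ((a ℕ.+ k) ℕ.* (b ℕ.+ k)) ≡ (+ a + + k) * (+ b + + k)
pos-*-+ a b k = trans (ℤ.pos-* (a ℕ.+ k) (b ℕ.+ k)) (cong₂ _*_ (ℤ.pos-+ a k) (ℤ.pos-+ b k))

third-difference-n[n-1] : (k : ℕ) →
  + ((7 ℕ.+ k) ℕ.* (6 ℕ.+ k)) - + 3 * + ((6 ℕ.+ k) ℕ.* (5 ℕ.+ k))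
    + + 3 * + ((5 ℕ.+ k) ℕ.* (4 ℕ.+ k)) - + ((4 ℕ.+ k) ℕ.* (3 ℕ.+ k)) ≡ + 0
third-difference-n[n-1] k
  rewrite pos-*-+ 7 6 k | pos-*-+ 6 5 k | pos-*-+ 5 4 k | pos-*-+ 4 3 k = vanishes (+ k)
  where
  vanishes : ∀ t → (+ 7 + t) * (+ 6 + t) - + 3 * ((+ 6 + t) * (+ 5 + t))
                   + + 3 * ((+ 5 + t) * (+ 4 + t)) - (+ 4 + t) * (+ 3 + t) ≡ + 0
  vanishes = solve-∀

generating-function : (n : ℕ) → (oneMinusXCubed ⊛ (λ m → + aFormula m)) n ≡ numerator n
generating-function 0 = refl
generating-function 1 = refl
generating-function 2 = refl
generating-function 3 = refl
generating-function 4 = refl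
generating-function 5 = refl
generating-function 6 = refl
generating-function (suc (suc (suc (suc (suc (suc (suc k))))))) =
  trans (third-difference (λ m → + aFormula m) (4 ℕ.+ k)) (third-difference-n[n-1] k)

theorem8 : Σ (ℕ → ℕ) λ a →
    ((n : ℕ) → Σ (List (Vec (Fin n) n)) λ L →
        Unique L
        × ((π : Vec (Fin n) n) → (π ∈ L) ⇔ (IsPerm π × Avoids p12 π))
        × length L ≡ a n)
    × ((n : ℕ) → a n ≡ aFormula n)
    × ((n : ℕ) → (oneMinusXCubed ⊛ (λ m → + a m)) n ≡ numerator n)
theorem8 = aFormula , avoiders , (λ _ → refl) , generating-function
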